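{- Let $r$ be a positive integer and let $\sigma,\rho\subseteq\mathbb N$ be finite or co-finite. There is a DN formula $\varphi_{r,\sigma,\rho}(X)$ such that for every graph $G$ and every $X\subseteq V(G)$, $G\models\varphi_{r,\sigma,\rho}(X)$ if and only if $X$ is a distance-$r$ $(\sigma,\rho)$-set in $G$.
   Context: For $v\in V(G)$, $N^r(v)=\{u\ne v:\mathrm{dist}_G(u,v)\le r\}$ and $N^r_d(U)=\{v:|N^r(v)\cap U|\ge d\}$ for $d,r\in\mathbb N^+$. A distance-$r$ $(\sigma,\rho)$-set of $G$ is $S\subseteq V(G)$ such that $|N^r(v)\cap S|\in\sigma$ for all $v\in S$ and $|N^r(v)\cap S|\in\rho$ for all $v\in V(G)\setminus S$. DN logic: existential MSO over (vertex-colored) graphs (quantification over vertices and vertex sets; atomic $E(x,y)$, $x=y$, $x\in X$, $\mathbf P(x)$; only existential quantifiers; negation only of quantifier-free formulas) extended by size measurements $|t|=m,|t|\le m,|t|\ge m$ and comparisons $t_1=t_2$, $t_1\subseteq t_2$, $t_1\supseteq t_2$, where neighborhood terms are built from set variables, unary relation symbols, $\emptyset$ by $N^r_d(\cdot)$ ($d,r\in\mathbb N^+$), complement, $\cap$, $\cup$, $\setminus$, and denote vertex sets in the obvious way. -}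

module Defs where

open import Data.Bool using (Bool; true; false; _∧_; _∨_; not; T)
open import Data.Nat using (ℕ; zero; suc; _≤_; _≤ᵇ_)
open import Data.Fin using (Fin; zero; suc)
open import Data.Fin.Properties using (_≟_)
open import Data.Fin.Subset using (Subset; ∣_∣; ∁; _∩_; _∪_; _─_; ⊥; _∈_; _∉_; _⊆_; _⊇_)
open import Data.Vec using (Vec; []; _∷_; lookup; tabulate)
open import Data.Product using (Σ; _×_)
open import Data.Sum using (_⊎_)
open import Data.Empty using () renaming (⊥ to Empty)
open import Relation.Nullary using (¬_)
open import Relation.Nullary.Decidable using (⌊_⌋)
open import Relation.Binary.PropositionalEquality using (_≡_)

record Graph (c : ℕ) : Set where
  field
    n      : ℕ
    E      : Fin n → Fin n → Bool
    sym    : ∀ u v → E u v ≡ E v u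
    irrefl : ∀ v → E v v ≡ false
    color  : Fin c → Subset n            -- interpretation of unary symbol P_i
open Graph public

anyFin : {n : ℕ} → (Fin n → Bool) → Bool
anyFin {zero}  f = false
anyFin {suc n} f = f zero ∨ anyFin (λ i → f (suc i))

-- within G r u v = true  iff  dist_G(u,v) ≤ r  (there is a walk of length ≤ r)
within : {c : ℕ} (G : Graph c) → ℕ → Fin (n G) → Fin (n G) → Bool
within G zero    u v = ⌊ u ≟ v ⌋
within G (suc r) u v = within G r u v ∨ anyFin (λ w → within G r u w ∧ E G w v)

Nbh : {c : ℕ} (G : Graph c) → ℕ → Fin (n G) → Subset (n G)
Nbh G r v = tabulate (λ u → not ⌊ u ≟ v ⌋ ∧ within G r u v)

NbhD : {c : ℕ} (G : Graph c) → (d r : ℕ) → Subset (n G) → Subset (n G)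
NbhD G d r U = tabulate (λ v → d ≤ᵇ ∣ Nbh G r v ∩ U ∣)

IsDistSigmaRhoSet : {c : ℕ} (G : Graph c) (r : ℕ) (σ ρ : ℕ → Bool) → Subset (n G) → Set
IsDistSigmaRhoSet G r σ ρ S =
  ∀ v → (v ∈ S → σ ∣ Nbh G r v ∩ S ∣ ≡ true)
      × (v ∉ S → ρ ∣ Nbh G r v ∩ S ∣ ≡ true)

FinOrCofin : (ℕ → Bool) → Set
FinOrCofin σ = Σ ℕ (λ b → (∀ m → b ≤ m → σ m ≡ false) ⊎ (∀ m → b ≤ m → σ m ≡ true))

-- DN logic: syntax. c = number of unary relation symbols,
-- v = number of free vertex variables, s = number of free set variables
-- (de Bruijn indices).

data Term (c s : ℕ) : Set where
  svar  : Fin s → Term c s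
  pred  : Fin c → Term c s
  empty : Term c s
  nbhd  : (d r : ℕ) → 1 ≤ d → 1 ≤ r → Term c s → Term c s
  compl : Term c s → Term c s
  _∩ₜ_  : Term c s → Term c s → Term c s
  _∪ₜ_  : Term c s → Term c s → Term c s
  _∖ₜ_  : Term c s → Term c s → Term c s

data QF (c v s : ℕ) : Set where
  edge    : Fin v → Fin v → QF c v s
  eqv     : Fin v → Fin v → QF c v s
  mem     : Fin v → Fin s → QF c v s
  haspred : Fin c → Fin v → QF c v s
  sizeEq  : Term c s → ℕ → QF c v s
  sizeLe  : Term c s → ℕ → QF c v s
  sizeGe  : Term c s → ℕ → QF c v s
  tmEq    : Term c s → Term c s → QF c v s
  tmSub   : Term c s → Term c s → QF c v s
  tmSup   : Term c s → Term c s → QF c v s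
  neg     : QF c v s → QF c v s
  and     : QF c v s → QF c v s → QF c v s
  or      : QF c v s → QF c v s → QF c v s

data DN (c v s : ℕ) : Set where
  qf    : QF c v s → DN c v s
  and   : DN c v s → DN c v s → DN c v s
  or    : DN c v s → DN c v s → DN c v s
  ∃vtx  : DN c (suc v) s → DN c v s
  ∃set  : DN c v (suc s) → DN c v s

⟦_⟧t : {c s : ℕ} → Term c s → (G : Graph c) → Vec (Subset (n G)) s → Subset (n G)
⟦ svar i ⟧t G β = lookup β i
⟦ pred p ⟧t G β = color G p
⟦ empty ⟧t G β = ⊥
⟦ nbhd d r _ _ t ⟧t G β = NbhD G d r (⟦ t ⟧t G β)
⟦ compl t ⟧t G β = ∁ (⟦ t ⟧t G β)
⟦ t ∩ₜ u ⟧t G β = ⟦ t ⟧t G β ∩ ⟦ u ⟧t G β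
⟦ t ∪ₜ u ⟧t G β = ⟦ t ⟧t G β ∪ ⟦ u ⟧t G β
⟦ t ∖ₜ u ⟧t G β = ⟦ t ⟧t G β ─ ⟦ u ⟧t G β

⟦_⟧q : {c v s : ℕ} → QF c v s → (G : Graph c) → Vec (Fin (n G)) v → Vec (Subset (n G)) s → Set
⟦ edge x y ⟧q G α β = E G (lookup α x) (lookup α y) ≡ true
⟦ eqv x y ⟧q G α β = lookup α x ≡ lookup α y
⟦ mem x X ⟧q G α β = lookup α x ∈ lookup β X
⟦ haspred p x ⟧q G α β = lookup α x ∈ color G p
⟦ sizeEq t m ⟧q G α β = ∣ ⟦ t ⟧t G β ∣ ≡ m
⟦ sizeLe t m ⟧q G α β = ∣ ⟦ t ⟧t G β ∣ ≤ m
⟦ sizeGe t m ⟧q G α β = m ≤ ∣ ⟦ t ⟧t G β ∣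
⟦ tmEq t u ⟧q G α β = ⟦ t ⟧t G β ≡ ⟦ u ⟧t G β
⟦ tmSub t u ⟧q G α β = ⟦ t ⟧t G β ⊆ ⟦ u ⟧t G β
⟦ tmSup t u ⟧q G α β = ⟦ t ⟧t G β ⊇ ⟦ u ⟧t G β
⟦ neg φ ⟧q G α β = ¬ (⟦ φ ⟧q G α β)
⟦ and φ ψ ⟧q G α β = ⟦ φ ⟧q G α β × ⟦ ψ ⟧q G α β
⟦ or φ ψ ⟧q G α β = ⟦ φ ⟧q G α β ⊎ ⟦ ψ ⟧q G α β

⟦_⟧ : {c v s : ℕ} → DN c v s → (G : Graph c) → Vec (Fin (n G)) v → Vec (Subset (n G)) s → Set
⟦ qf φ ⟧ G α β = ⟦ φ ⟧q G α β
⟦ and φ ψ ⟧ G α β = ⟦ φ ⟧ G α β × ⟦ ψ ⟧ G α β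
⟦ or φ ψ ⟧ G α β = ⟦ φ ⟧ G α β ⊎ ⟦ ψ ⟧ G α β
⟦ ∃vtx φ ⟧ G α β = Σ (Fin (n G)) (λ x → ⟦ φ ⟧ G (x ∷ α) β)
⟦ ∃set φ ⟧ G α β = Σ (Subset (n G)) (λ X → ⟦ φ ⟧ G α (X ∷ β))

{-# OPTIONS --safe #-}
module Submission where

-- Write c(v) = |N^r(v) ∩ X|. The term N^r_k(X) denotes {v : c(v) ≥ k}, so
-- N^r_k(X) ∩ ∁ N^r_{k+1}(X) denotes {v : c(v) = k}; overriding the value of a
-- predicate on ℕ at a single point is then expressible, and a finite or
-- co-finite set of counts is a finite number of such overrides of ∅ or ℕ.
-- Hence {v : c(v) ∈ σ} and {v : c(v) ∈ ρ} are neighbourhood terms T_σ, T_ρ, and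
-- the quantifier-free formula X ⊆ T_σ ∧ ∁ X ⊆ T_ρ defines the (σ,ρ)-sets.

open import Defs hiding (sym)
open import Data.Bool using (Bool; true; false; _∧_; _∨_; not; T; if_then_else_)
open import Data.Bool.Properties using (∧-zeroʳ; ∧-identityʳ; ∨-identityʳ; T-≡)
open import Data.Nat using (ℕ; zero; suc; _≤_; _≤ᵇ_; _≡ᵇ_; z≤n; s≤s)
open import Data.Nat.Properties using (≡ᵇ⇒≡; ≡⇒≡ᵇ; ≤∧≢⇒<)
open import Data.Fin using (Fin)
open import Data.Fin.Subset using (Subset; ∣_∣; _∩_; _∈_)
open import Data.Fin.Subset.Properties using (x∉p⇒x∈∁p; x∈∁p⇒x∉p)
open import Data.Vec using ([]; _∷_; lookup)
open import Data.Vec.Properties using (lookup-map; lookup-zipWith; lookup-replicate; lookup∘tabulate; []=⇒lookup; lookup⇒[]=)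
open import Data.Product using (Σ; _,_; proj₁; proj₂)
open import Data.Sum using (inj₁; inj₂)
open import Function using (_∘_; const)
open import Function.Bundles using (_⇔_; mk⇔; Equivalence)
open import Relation.Binary.PropositionalEquality using (_≡_; _≢_; _≗_; refl; sym; trans; cong; cong₂; subst)

open Equivalence using (to; from)

if-as-∧∨ : ∀ e x y → (if e then y else x) ≡ (x ∧ not e) ∨ (y ∧ e)
if-as-∧∨ true  x y = sym (cong₂ _∨_ (∧-zeroʳ x) (∧-identityʳ y))
if-as-∧∨ false x y = sym (trans (cong₂ _∨_ (∧-identityʳ x) (∧-zeroʳ y)) (∨-identityʳ x))

≤ᵇ-∧-not-suc-≤ᵇ : ∀ k m → (k ≤ᵇ m) ∧ not (suc k ≤ᵇ m) ≡ (m ≡ᵇ k)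
≤ᵇ-∧-not-suc-≤ᵇ zero          zero    = refl
≤ᵇ-∧-not-suc-≤ᵇ zero          (suc m) = refl
≤ᵇ-∧-not-suc-≤ᵇ (suc k)       zero    = refl
≤ᵇ-∧-not-suc-≤ᵇ (suc zero)    (suc m) = ≤ᵇ-∧-not-suc-≤ᵇ zero m
≤ᵇ-∧-not-suc-≤ᵇ (suc (suc k)) (suc m) = ≤ᵇ-∧-not-suc-≤ᵇ (suc k) m

≡ᵇ-true⇒≡ : ∀ {m k} → (m ≡ᵇ k) ≡ true → m ≡ k
≡ᵇ-true⇒≡ {m} {k} eq = ≡ᵇ⇒≡ m k (from T-≡ eq)

≡ᵇ-false⇒≢ : ∀ {m k} → (m ≡ᵇ k) ≡ false → m ≢ k
≡ᵇ-false⇒≢ {m} {k} eq m≡k = subst T eq (≡⇒≡ᵇ m k m≡k)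

_[_↦_] : (ℕ → Bool) → ℕ → Bool → ℕ → Bool
(f [ k ↦ x ]) m = if m ≡ᵇ k then x else f m

[↦]-restore : ∀ f k x → (f [ k ↦ x ] [ k ↦ f k ]) ≗ f
[↦]-restore f k x m with m ≡ᵇ k in eq
... | true  = cong f (sym (≡ᵇ-true⇒≡ eq))
... | false = refl

[↦]-eventually : ∀ f k x → (∀ m → suc k ≤ m → f m ≡ x) → ∀ m → k ≤ m → (f [ k ↦ x ]) m ≡ x
[↦]-eventually f k x tail m k≤m with m ≡ᵇ k in eq
... | true  = refl
... | false = tail m (≤∧≢⇒< k≤m (≡ᵇ-false⇒≢ eq ∘ sym))

module _ {c : ℕ} (r : ℕ) where

  count : (G : Graph c) → Subset (n G) → Fin (n G) → ℕ
  count G X v = ∣ Nbh G r v ∩ X ∣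

  record Realises (t : Term c 1) (f : ℕ → Bool) : Set where
    constructor realises
    field
      lookup-⟦⟧ : ∀ G X v → lookup (⟦ t ⟧t G (X ∷ [])) v ≡ f (count G X v)
  open Realises

  realises-resp : ∀ {t f g} → f ≗ g → Realises t f → Realises t g
  realises-resp f≗g rt = realises λ G X v → trans (lookup-⟦⟧ rt G X v) (f≗g _)

  realises-empty : Realises empty (const false)
  realises-empty = realises λ G X v → lookup-replicate v false

  realises-compl : ∀ {t f} → Realises t f → Realises (compl t) (not ∘ f)
  realises-compl {t} rt = realises λ G X v →
    trans (lookup-map v not (⟦ t ⟧t G (X ∷ []))) (cong not (lookup-⟦⟧ rt G X v))

  realises-∩ : ∀ {t u f g} → Realises t f → Realises u g → Realises (t ∩ₜ u) (λ m → f m ∧ g m)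
  realises-∩ {t} {u} rt ru = realises λ G X v →
    trans (lookup-zipWith _∧_ v (⟦ t ⟧t G (X ∷ [])) (⟦ u ⟧t G (X ∷ [])))
          (cong₂ _∧_ (lookup-⟦⟧ rt G X v) (lookup-⟦⟧ ru G X v))

  realises-∪ : ∀ {t u f g} → Realises t f → Realises u g → Realises (t ∪ₜ u) (λ m → f m ∨ g m)
  realises-∪ {t} {u} rt ru = realises λ G X v →
    trans (lookup-zipWith _∨_ v (⟦ t ⟧t G (X ∷ [])) (⟦ u ⟧t G (X ∷ [])))
          (cong₂ _∨_ (lookup-⟦⟧ rt G X v) (lookup-⟦⟧ ru G X v))

  constant : Bool → Term c 1
  constant true  = compl empty
  constant false = empty

  realises-constant : ∀ x → Realises (constant x) (const x)
  realises-constant true  = realises-compl realises-empty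
  realises-constant false = realises-empty

  ∈-realised : ∀ {t f} → Realises t f → ∀ G X v → (v ∈ ⟦ t ⟧t G (X ∷ [])) ⇔ (f (count G X v) ≡ true)
  ∈-realised rt G X v = mk⇔ (λ v∈t → trans (sym (lookup-⟦⟧ rt G X v)) ([]=⇒lookup v∈t))
                            (λ fv → lookup⇒[]= v _ (trans (lookup-⟦⟧ rt G X v) fv))

  σρ-formula : Term c 1 → Term c 1 → DN c 0 1
  σρ-formula tσ tρ = qf (and (tmSub (svar Fin.zero) tσ) (tmSub (compl (svar Fin.zero)) tρ))

  σρ-formula-correct : ∀ {tσ tρ σ ρ} → Realises tσ σ → Realises tρ ρ →
    ∀ G X → (⟦ σρ-formula tσ tρ ⟧ G [] (X ∷ [])) ⇔ IsDistSigmaRhoSet G r σ ρ X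
  σρ-formula-correct rσ rρ G X = mk⇔
    (λ (X⊆Tσ , ∁X⊆Tρ) v →
        (λ v∈X → to (∈-realised rσ G X v) (X⊆Tσ v∈X))
      , (λ v∉X → to (∈-realised rρ G X v) (∁X⊆Tρ (x∉p⇒x∈∁p v∉X))))
    (λ isSet →
        (λ {v} v∈X → from (∈-realised rσ G X v) (proj₁ (isSet v) v∈X))
      , (λ {v} v∈∁X → from (∈-realised rρ G X v) (proj₂ (isSet v) (x∈∁p⇒x∉p v∈∁X))))

  module _ (1≤r : 1 ≤ r) where

    -- N^r_0 is not a term (d ≥ 1 is required), but it is the whole vertex set.
    atLeast : ℕ → Term c 1
    atLeast zero    = constant true
    atLeast (suc k) = nbhd (suc k) r (s≤s z≤n) 1≤r (svar Fin.zero)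

    realises-atLeast : ∀ k → Realises (atLeast k) (k ≤ᵇ_)
    realises-atLeast zero    = realises-constant true
    realises-atLeast (suc k) = realises λ G X v → lookup∘tabulate (λ w → suc k ≤ᵇ count G X w) v

    exactly : ℕ → Term c 1
    exactly k = atLeast k ∩ₜ compl (atLeast (suc k))

    realises-exactly : ∀ k → Realises (exactly k) (_≡ᵇ k)
    realises-exactly k = realises-resp (≤ᵇ-∧-not-suc-≤ᵇ k)
      (realises-∩ (realises-atLeast k) (realises-compl (realises-atLeast (suc k))))

    update : Term c 1 → ℕ → Bool → Term c 1
    update t k x = (t ∩ₜ compl (exactly k)) ∪ₜ (constant x ∩ₜ exactly k)

    realises-update : ∀ {t f} k x → Realises t f → Realises (update t k x) (f [ k ↦ x ])
    realises-update {f = f} k x rt = realises-resp (λ m → sym (if-as-∧∨ (m ≡ᵇ k) (f m) x))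
      (realises-∪ (realises-∩ rt (realises-compl (realises-exactly k)))
                  (realises-∩ (realises-constant x) (realises-exactly k)))

    eventuallyConstant-realisable : ∀ b x f → (∀ m → b ≤ m → f m ≡ x) → Σ (Term c 1) (λ t → Realises t f)
    eventuallyConstant-realisable zero x f tail =
      constant x , realises-resp (λ m → sym (tail m z≤n)) (realises-constant x)
    eventuallyConstant-realisable (suc b) x f tail
      with eventuallyConstant-realisable b x (f [ b ↦ x ]) ([↦]-eventually f b x tail)
    ... | t , rt = update t b (f b) , realises-resp ([↦]-restore f b x) (realises-update b (f b) rt)

    finOrCofin-realisable : ∀ {f} → FinOrCofin f → Σ (Term c 1) (λ t → Realises t f)
    finOrCofin-realisable (b , inj₁ tail) = eventuallyConstant-realisable b false _ tail
    finOrCofin-realisable (b , inj₂ tail) = eventuallyConstant-realisable b true  _ tail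

proposition6p3 : (r : ℕ) → 1 ≤ r → (σ ρ : ℕ → Bool) → FinOrCofin σ → FinOrCofin ρ →
    Σ (DN 0 0 1) (λ φ → (G : Graph 0) (X : Subset (n G)) →
      (⟦ φ ⟧ G [] (X ∷ [])) ⇔ IsDistSigmaRhoSet G r σ ρ X)
proposition6p3 r 1≤r σ ρ σ-finOrCofin ρ-finOrCofin
  with finOrCofin-realisable r 1≤r σ-finOrCofin | finOrCofin-realisable r 1≤r ρ-finOrCofin
... | tσ , rσ | tρ , rρ = σρ-formula r tσ tρ , σρ-formula-correct r rσ rρ
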